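{- Let $\mathcal{M}$ be an $\mathcal{L}$-structure with $\mathcal{M}\models\mathrm{MOST}$ and let $I\subseteq M$ be an $H$-cut of $\mathcal{M}$. Then for all $\kappa\in I$: $\langle I,\in^{\mathcal M}\rangle\models(\kappa\text{ is a cardinal})$ if and only if $\mathcal{M}\models(\kappa\text{ is a cardinal})$; and if $\mathcal{M}\models(\kappa\text{ is a cardinal})$ then $H_\kappa^{\mathcal M}=H_\kappa^{\langle I,\in^{\mathcal M}\rangle}$.
   Context: $\mathcal{L}$ is the language with one binary relation $\in$; for $a\in M$, $a^*=\{x\in M:\mathcal M\models x\in a\}$. $\mathrm{Mac}$: extensionality, pairing, emptyset, union, infinity, powerset, transitive containment, $\Delta_0$-separation, set foundation, and "every set can be well-ordered". $\mathrm{MOST}=\mathrm{Mac}+\Sigma_1$-separation$+\Delta_0$-collection. In $\mathrm{MOST}$, for each cardinal $\kappa$ the set $H_\kappa$ of all sets whose transitive closure has cardinality $<\kappa$ exists. For $\mathcal{L}$-structures $\mathcal{A}\subseteq\mathcal{B}$: end-extension means members (in $\mathcal B$) of elements of $A$ lie in $A$; powerset-preserving means additionally every $x\in B$ with $\mathcal B\models x\subseteq y$ for some $y\in A$ lies in $A$; topless means end-extension, $A\ne B$, and every $C\in B$ with $C^*\subseteq\mathrm{Ord}^{\mathcal A}$ lies in $A$. For $\mathcal M\models\mathrm{MOST}$, $I\subseteq M$ is an $H$-cut if $\mathcal M$ is a topless powerset-preserving end-extension of the substructure $\langle I,\in^{\mathcal M}\rangle$ and $\langle I,\in^{\mathcal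 M}\rangle\models\mathrm{MOST}$. -}

module Defs where

open import Data.Nat using (ℕ; zero; suc)
open import Data.Fin using (Fin)
open import Data.Vec using (Vec; lookup; _∷_)
open import Data.Bool using (Bool; T)
open import Data.Product using (Σ; _×_; _,_; proj₁)
open import Data.Sum using (_⊎_)
open import Data.Empty using (⊥)
open import Relation.Nullary using (¬_)
open import Relation.Binary.PropositionalEquality using (_≡_)
open import Function.Bundles using (_⇔_)

-- L-structures: one binary relation ∈ ; equality is interpreted as identity.

record Structure : Set₁ where
  field
    U   : Set
    _∈_ : U → U → Set

-- First-order syntax over L (de Bruijn, n free variables), with bounded
-- quantifiers as primitives (∀x∈y / ∃x∈y, the new variable is index 0).

data Formula (n : ℕ) : Set where
  _∈̇_  : Fin n → Fin n → Formula n
  _≐_  : Fin n → Fin n → Formula n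
  ⊥̇    : Formula n
  _⇒̇_  : Formula n → Formula n → Formula n
  _∧̇_  : Formula n → Formula n → Formula n
  _∨̇_  : Formula n → Formula n → Formula n
  ∀̇    : Formula (suc n) → Formula n
  ∃̇    : Formula (suc n) → Formula n
  ∀∈̇   : Fin n → Formula (suc n) → Formula n
  ∃∈̇   : Fin n → Formula (suc n) → Formula n

data Δ₀ {n : ℕ} : Formula n → Set where
  mem  : ∀ i j → Δ₀ (i ∈̇ j)
  eq   : ∀ i j → Δ₀ (i ≐ j)
  fls  : Δ₀ ⊥̇
  imp  : ∀ {φ ψ} → Δ₀ φ → Δ₀ ψ → Δ₀ (φ ⇒̇ ψ)
  conj : ∀ {φ ψ} → Δ₀ φ → Δ₀ ψ → Δ₀ (φ ∧̇ ψ)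
  disj : ∀ {φ ψ} → Δ₀ φ → Δ₀ ψ → Δ₀ (φ ∨̇ ψ)
  ball : ∀ y {φ} → Δ₀ φ → Δ₀ (∀∈̇ y φ)
  bex  : ∀ y {φ} → Δ₀ φ → Δ₀ (∃∈̇ y φ)

data Σ₁ {n : ℕ} : Formula n → Set where
  base : ∀ {φ} → Δ₀ φ → Σ₁ φ
  ex   : ∀ {φ} → Σ₁ φ → Σ₁ (∃̇ φ)

module _ (S : Structure) where
  open Structure S

  Sat : ∀ {n} → Vec U n → Formula n → Set
  Sat e (i ∈̇ j)   = lookup e i ∈ lookup e j
  Sat e (i ≐ j)   = lookup e i ≡ lookup e j
  Sat e ⊥̇         = ⊥
  Sat e (φ ⇒̇ ψ)   = Sat e φ → Sat e ψ
  Sat e (φ ∧̇ ψ)   = Sat e φ × Sat e ψ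
  Sat e (φ ∨̇ ψ)   = Sat e φ ⊎ Sat e ψ
  Sat e (∀̇ φ)     = (a : U) → Sat (a ∷ e) φ
  Sat e (∃̇ φ)     = Σ U λ a → Sat (a ∷ e) φ
  Sat e (∀∈̇ y φ)  = (a : U) → a ∈ lookup e y → Sat (a ∷ e) φ
  Sat e (∃∈̇ y φ)  = Σ U λ a → a ∈ lookup e y × Sat (a ∷ e) φ

  _⊆_ : U → U → Set
  x ⊆ y = (z : U) → z ∈ x → z ∈ y

  Transitive : U → Set
  Transitive t = (y : U) → y ∈ t → y ⊆ t

  Empty : U → Set
  Empty e = (z : U) → ¬ (z ∈ e)

  IsDoubleton : U → U → U → Set
  IsDoubleton z a b = (w : U) → (w ∈ z) ⇔ (w ≡ a ⊎ w ≡ b)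

  IsPair : U → U → U → Set
  IsPair p a b = (z : U) → (z ∈ p) ⇔ (IsDoubleton z a a ⊎ IsDoubleton z a b)

  Rel : U → U → U → Set
  Rel r a b = Σ U λ p → p ∈ r × IsPair p a b

  WellOrders : U → U → Set
  WellOrders r x =
    ((p : U) → p ∈ r → Σ U λ a → a ∈ x × Σ U λ b → b ∈ x × IsPair p a b)
    × ((a : U) → a ∈ x → ¬ Rel r a a)
    × ((a b c : U) → a ∈ x → b ∈ x → c ∈ x → Rel r a b → Rel r b c → Rel r a c)
    × ((a b : U) → a ∈ x → b ∈ x → Rel r a b ⊎ a ≡ b ⊎ Rel r b a)
    × ((y : U) → y ⊆ x → (Σ U λ z → z ∈ y) →
         Σ U λ m → m ∈ y × ((z : U) → z ∈ y → ¬ Rel r z m))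

  Ordinal : U → Set
  Ordinal k =
    Transitive k
    × ((x y z : U) → x ∈ k → y ∈ k → z ∈ k → x ∈ y → y ∈ z → x ∈ z)
    × ((x y : U) → x ∈ k → y ∈ k → x ∈ y ⊎ x ≡ y ⊎ y ∈ x)

  Bijection : U → U → U → Set
  Bijection f a b =
    ((p : U) → p ∈ f → Σ U λ x → x ∈ a × Σ U λ y → y ∈ b × IsPair p x y)
    × ((x : U) → x ∈ a → Σ U λ y → y ∈ b × Rel f x y)
    × ((x y y′ : U) → Rel f x y → Rel f x y′ → y ≡ y′)
    × ((x x′ y : U) → Rel f x y → Rel f x′ y → x ≡ x′)
    × ((y : U) → y ∈ b → Σ U λ x → x ∈ a × Rel f x y)

  Cardinal : U → Set
  Cardinal k = Ordinal k × ((α : U) → α ∈ k → ¬ (Σ U λ f → Bijection f α k))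

  IsTC : U → U → Set
  IsTC t x = x ⊆ t × Transitive t × ((s : U) → x ⊆ s → Transitive s → t ⊆ s)

  SmallTC : U → U → Set
  SmallTC k x = Σ U λ t → IsTC t x × Σ U λ α → α ∈ k × Σ U λ f → Bijection f α t

  IsH : U → U → Set
  IsH k h = (x : U) → (x ∈ h) ⇔ SmallTC k x

  record MOST : Set where
    field
      extensionality : (x y : U) → ((z : U) → (z ∈ x) ⇔ (z ∈ y)) → x ≡ y
      pairing        : (x y : U) → Σ U λ p → IsDoubleton p x y
      emptyset       : Σ U Empty
      union          : (x : U) → Σ U λ u → (z : U) →
                         (z ∈ u) ⇔ (Σ U λ y → y ∈ x × z ∈ y)
      infinity       : Σ U λ w → (Σ U λ e → e ∈ w × Empty e)
                         × ((y : U) → y ∈ w → Σ U λ s → s ∈ w ×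
                              ((z : U) → (z ∈ s) ⇔ (z ∈ y ⊎ z ≡ y)))
      powerset       : (x : U) → Σ U λ p → (z : U) → (z ∈ p) ⇔ (z ⊆ x)
      transContain   : (x : U) → Σ U λ t → x ⊆ t × Transitive t
      Δ₀-separation  : ∀ {n} (φ : Formula (suc n)) → Δ₀ φ → (ps : Vec U n) →
                         (x : U) → Σ U λ y → (z : U) →
                           (z ∈ y) ⇔ (z ∈ x × Sat (z ∷ ps) φ)
      setFoundation  : (x : U) → (Σ U λ z → z ∈ x) →
                         Σ U λ y → y ∈ x × ((z : U) → z ∈ y → ¬ (z ∈ x))
      wellOrdering   : (x : U) → Σ U λ r → WellOrders r x
      Σ₁-separation  : ∀ {n} (φ : Formula (suc n)) → Σ₁ φ → (ps : Vec U n) →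
                         (x : U) → Σ U λ y → (z : U) →
                           (z ∈ y) ⇔ (z ∈ x × Sat (z ∷ ps) φ)
      Δ₀-collection  : ∀ {n} (φ : Formula (suc (suc n))) → Δ₀ φ → (ps : Vec U n) →
                         (a : U) →
                         ((x : U) → x ∈ a → Σ U λ y → Sat (y ∷ x ∷ ps) φ) →
                         Σ U λ b → (x : U) → x ∈ a →
                           Σ U λ y → y ∈ b × Sat (y ∷ x ∷ ps) φ

Sub : (S : Structure) → (Structure.U S → Bool) → Structure
Sub S I = record
  { U   = Σ (Structure.U S) (λ x → T (I x))
  ; _∈_ = λ a b → Structure._∈_ S (proj₁ a) (proj₁ b) }

module _ (S : Structure) (I : Structure.U S → Bool) where
  open Structure S

  EndExtension : Set
  EndExtension = (x y : U) → T (I x) → y ∈ x → T (I y)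

  PowersetPreserving : Set
  PowersetPreserving =
    EndExtension × ((x y : U) → T (I y) → _⊆_ S x y → T (I x))

  Topless : Set
  Topless =
    EndExtension
    × (Σ U λ x → ¬ T (I x))
    × ((C : U) →
        ((x : U) → x ∈ C → Σ (T (I x)) λ ix → Ordinal (Sub S I) (x , ix)) →
        T (I C))

  HCut : Set
  HCut = Topless × PowersetPreserving × MOST (Sub S I)

module Submission where

-- Cardinals are absolute between I and M because ordinals are Δ₀ and a bijection between
-- members of I is a subset of 𝒫𝒫(a ∪ b), hence lies in I by powerset preservation.
-- The substance is that every x with |TC(x)| < κ in M already lies in I. Pull ∈ on
-- t = TC(x) back along a bijection f : α ≅ t (α ∈ κ) to a well-founded relation
-- E ⊆ 𝒫𝒫κ; then E ∈ I, and Σ₁-separation with Δ₀-collection let I build the Mostowski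
-- collapse of E by recursion along E. Collapses are unique, so it agrees with f and
-- t ⊆ ⋃⋃⋃(collapses) ∈ I. Collecting collapses for all E ∈ 𝒫𝒫𝒫κ at once gives a single
-- bound in I for every such t, which also puts H_κ^M into I.

open import Defs
open import Level using (0ℓ)
open import Axiom.ExcludedMiddle using (ExcludedMiddle)
open import Data.Bool using (Bool; T; true; false; _∧_)
open import Data.Bool.Properties using (T-∧; T-irrelevant)
open import Data.Product using (Σ; _×_; _,_; proj₁; proj₂)
open import Data.Sum using (_⊎_; inj₁; inj₂; [_,_]′; reduce)
open import Data.Empty using (⊥; ⊥-elim)
open import Data.Nat using (suc)
open import Data.Fin using (Fin; zero; suc; #_; _↑ʳ_)
open import Data.Vec using (Vec; []; _∷_; lookup; map)
open import Data.Vec.Properties using (lookup-map)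
open import Relation.Nullary using (¬_; yes; no; decidable-stable)
open import Relation.Binary.PropositionalEquality using (_≡_; refl; sym; trans; cong; subst; subst₂)
open import Function.Base using (case_of_)
open import Function.Bundles using (_⇔_; mk⇔; Equivalence)
open import Function.Construct.Composition using (_⇔-∘_)
open import Function.Construct.Symmetry using (⇔-sym)

open Equivalence using (to; from)

bounded : ∀ {n} → Formula n → Bool
bounded (φ ⇒̇ ψ)   = bounded φ ∧ bounded ψ
bounded (φ ∧̇ ψ)   = bounded φ ∧ bounded ψ
bounded (φ ∨̇ ψ)   = bounded φ ∧ bounded ψ
bounded (∀̇ φ)     = false
bounded (∃̇ φ)     = false
bounded (∀∈̇ y φ)  = bounded φ
bounded (∃∈̇ y φ)  = bounded φ
bounded _         = true

bounded⇒Δ₀ : ∀ {n} (φ : Formula n) → T (bounded φ) → Δ₀ φ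
bounded⇒Δ₀ (i ∈̇ j)  _ = mem i j
bounded⇒Δ₀ (i ≐ j)  _ = eq i j
bounded⇒Δ₀ ⊥̇        _ = fls
bounded⇒Δ₀ (φ ⇒̇ ψ)  b = imp (bounded⇒Δ₀ φ (proj₁ (to T-∧ b))) (bounded⇒Δ₀ ψ (proj₂ (to T-∧ b)))
bounded⇒Δ₀ (φ ∧̇ ψ)  b = conj (bounded⇒Δ₀ φ (proj₁ (to T-∧ b))) (bounded⇒Δ₀ ψ (proj₂ (to T-∧ b)))
bounded⇒Δ₀ (φ ∨̇ ψ)  b = disj (bounded⇒Δ₀ φ (proj₁ (to T-∧ b))) (bounded⇒Δ₀ ψ (proj₂ (to T-∧ b)))
bounded⇒Δ₀ (∀∈̇ y φ) b = ball y (bounded⇒Δ₀ φ b)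
bounded⇒Δ₀ (∃∈̇ y φ) b = bex y (bounded⇒Δ₀ φ b)

bounded-Δ₀ : ∀ {n} {φ : Formula n} {b : T (bounded φ)} → Δ₀ φ
bounded-Δ₀ {φ = φ} {b} = bounded⇒Δ₀ φ b

doubletonᶠ : ∀ {n} → Fin n → Fin n → Fin n → Formula n
doubletonᶠ z a b = ∀∈̇ z ((zero ≐ suc a) ∨̇ (zero ≐ suc b)) ∧̇ ((a ∈̇ z) ∧̇ (b ∈̇ z))

pairᶠ : ∀ {n} → Fin n → Fin n → Fin n → Formula n
pairᶠ p a b = ∃∈̇ p (∃∈̇ (suc p) (doubletonᶠ (# 1) (2 ↑ʳ a) (2 ↑ʳ a)
   ∧̇ (doubletonᶠ (# 0) (2 ↑ʳ a) (2 ↑ʳ b) ∧̇ ∀∈̇ (2 ↑ʳ p) (((# 0) ≐ (# 2)) ∨̇ ((# 0) ≐ (# 1))))))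

relᶠ : ∀ {n} → Fin n → Fin n → Fin n → Formula n
relᶠ g a y = ∃∈̇ g (pairᶠ (# 0) (suc a) (suc y))

inDomᶠ : ∀ {n} → Fin n → Fin n → Formula n
inDomᶠ g a = ∃∈̇ g (∃∈̇ (# 0) (∃∈̇ (# 0) (pairᶠ (# 2) (3 ↑ʳ a) (# 0))))

graphOverᶠ : ∀ {n} → Fin n → Fin n → Formula n
graphOverᶠ α g = ∀∈̇ g (∃∈̇ (# 0) (∃∈̇ (# 0) (∃∈̇ (# 2) (∃∈̇ (# 0)
          (((# 2) ∈̇ (5 ↑ʳ α)) ∧̇ pairᶠ (# 4) (# 2) (# 0))))))

downClosedᶠ : ∀ {n} → Fin n → Fin n → Formula n
downClosedᶠ E g = ∀∈̇ g (∀∈̇ (# 0) (∀∈̇ (# 0) (∀∈̇ (# 1) (pairᶠ (# 3) (# 1) (# 0) ⇒̇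
   ∀∈̇ (4 ↑ʳ E) (∀∈̇ (# 0) (∀∈̇ (# 0) (pairᶠ (# 2) (# 0) (# 4) ⇒̇ inDomᶠ (7 ↑ʳ g) (# 0))))))))

collapseEqᶠ : ∀ {n} → Fin n → Fin n → Formula n
collapseEqᶠ E g = ∀∈̇ g (∀∈̇ (# 0) (∀∈̇ (# 0) (∀∈̇ (# 1) (pairᶠ (# 3) (# 1) (# 0) ⇒̇
   ((∀∈̇ (# 0) (∃∈̇ (5 ↑ʳ E) (∃∈̇ (# 0) (∃∈̇ (# 0) (pairᶠ (# 2) (# 0) (# 5) ∧̇ relᶠ (8 ↑ʳ g) (# 0) (# 3))))))
    ∧̇ (∀∈̇ (4 ↑ʳ E) (∀∈̇ (# 0) (∀∈̇ (# 0) (∀∈̇ (7 ↑ʳ g) (∀∈̇ (# 0) (∀∈̇ (# 0)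
         (pairᶠ (# 5) (# 3) (# 7) ⇒̇ (pairᶠ (# 2) (# 3) (# 0) ⇒̇ ((# 0) ∈̇ (# 6)))))))))))))))

partialCollapseᶠ : ∀ {n} → Fin n → Fin n → Fin n → Formula n
partialCollapseᶠ E α g = graphOverᶠ α g ∧̇ (downClosedᶠ E g ∧̇ collapseEqᶠ E g)

fieldInDomᶠ : ∀ {n} → Fin n → Fin n → Formula n
fieldInDomᶠ E g = ∀∈̇ E (∀∈̇ (# 0) (∀∈̇ (# 0) (inDomᶠ (3 ↑ʳ g) (# 0))))

-- Doubleton₀, Pair₀, Rel₀, InDom₀, FieldInDom and PartialCollapse are definitionally the
-- satisfaction of doubletonᶠ, pairᶠ, relᶠ, inDomᶠ, fieldInDomᶠ and partialCollapseᶠ; since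
-- all their quantifiers are bounded, they are absolute between I and M.
module BoundedNotions (S : Structure) where
  open Structure S

  Doubleton₀ : U → U → U → Set
  Doubleton₀ z a b = ((w : U) → w ∈ z → w ≡ a ⊎ w ≡ b) × (a ∈ z × b ∈ z)

  Pair₀ : U → U → U → Set
  Pair₀ p a b = Σ U λ s₁ → s₁ ∈ p × Σ U λ s₂ → s₂ ∈ p ×
    (Doubleton₀ s₁ a a × (Doubleton₀ s₂ a b × ((s : U) → s ∈ p → s ≡ s₁ ⊎ s ≡ s₂)))

  Rel₀ : U → U → U → Set
  Rel₀ g a y = Σ U λ p → p ∈ g × Pair₀ p a y

  InDom₀ : U → U → Set
  InDom₀ g a = Σ U λ p → p ∈ g × Σ U λ u → u ∈ p × Σ U λ y → y ∈ u × Pair₀ p a y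

  GraphOver : U → U → Set
  GraphOver α g = (p : U) → p ∈ g → Σ U λ u → u ∈ p × Σ U λ a → a ∈ u × Σ U λ v → v ∈ p ×
           Σ U λ y → y ∈ v × (a ∈ α × Pair₀ p a y)

  DownClosed : U → U → Set
  DownClosed E g = (p : U) → p ∈ g → (u : U) → u ∈ p → (b : U) → b ∈ u → (y : U) → y ∈ u →
    Pair₀ p b y → (r : U) → r ∈ E → (w : U) → w ∈ r → (c : U) → c ∈ w → Pair₀ r c b → InDom₀ g c

  CollapseEq : U → U → Set
  CollapseEq E g = (p : U) → p ∈ g → (u : U) → u ∈ p → (b : U) → b ∈ u → (y : U) → y ∈ u →
    Pair₀ p b y →
    (((z : U) → z ∈ y → Σ U λ r → r ∈ E × Σ U λ w → w ∈ r × Σ U λ c → c ∈ w × (Pair₀ r c b × Rel₀ g c z))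
    × ((r : U) → r ∈ E → (w : U) → w ∈ r → (c : U) → c ∈ w → (q : U) → q ∈ g → (v : U) → v ∈ q →
        (z : U) → z ∈ v → Pair₀ r c b → Pair₀ q c z → z ∈ y))

  FieldInDom : U → U → Set
  FieldInDom E g = (r : U) → r ∈ E → (u : U) → u ∈ r → (a : U) → a ∈ u → InDom₀ g a

  PartialCollapse : U → U → U → Set
  PartialCollapse E α g = GraphOver α g × (DownClosed E g × CollapseEq E g)

  -- g is a Mostowski collapse of E on an E-downward closed part of α: g(b) = {g(c) : c E b}.
  record Collapse (E α g : U) : Set where
    field
      graph    : ∀ {p} → p ∈ g → Σ U λ a → Σ U λ y → a ∈ α × Pair₀ p a y
      downward : ∀ {b y c} → Rel₀ g b y → Rel₀ E c b → InDom₀ g c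
      values⊆  : ∀ {b y z} → Rel₀ g b y → z ∈ y → Σ U λ c → Rel₀ E c b × Rel₀ g c z
      values⊇  : ∀ {b y c z} → Rel₀ g b y → Rel₀ E c b → Rel₀ g c z → z ∈ y

  WellFoundedOn : U → U → Set
  WellFoundedOn E α = (s : U) → _⊆_ S s α → (Σ U λ z → z ∈ s) →
                      Σ U λ m → m ∈ s × ((c : U) → c ∈ s → ¬ Rel₀ E c m)

module BoundedNotions-properties (S : Structure) where
  open Structure S
  open BoundedNotions S

  Doubleton₀-singleton : ∀ {z a w} → Doubleton₀ z a a → w ∈ z → w ≡ a
  Doubleton₀-singleton D w∈z = reduce (proj₁ D _ w∈z)

  Pair₀-injective₁ : ∀ {p a b c d} → Pair₀ p a b → Pair₀ p c d → a ≡ c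
  Pair₀-injective₁ (s₁ , _ , s₂ , _ , D₁ , D₂ , H) (t₁ , t₁∈p , _ , _ , E₁ , _ , _) =
    Doubleton₀-singleton E₁ ([ (λ e → subst (_ ∈_) (sym e) (proj₁ (proj₂ D₁)))
                             , (λ e → subst (_ ∈_) (sym e) (proj₁ (proj₂ D₂))) ]′ (H t₁ t₁∈p))

  private
    Pair₀-second : ∀ {p a b d} → Pair₀ p a b → Pair₀ p a d → b ≡ a ⊎ b ≡ d
    Pair₀-second (_ , _ , s₂ , s₂∈p , _ , D₂ , _) (_ , _ , _ , _ , E₁ , E₂ , K) =
      [ (λ e → inj₁ (Doubleton₀-singleton E₁ (subst (_ ∈_) e (proj₂ (proj₂ D₂)))))
      , (λ e → proj₁ E₂ _ (subst (_ ∈_) e (proj₂ (proj₂ D₂)))) ]′ (K s₂ s₂∈p)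

  Pair₀-injective₂ : ∀ {p a b c d} → Pair₀ p a b → Pair₀ p c d → b ≡ d
  Pair₀-injective₂ P Q with Pair₀-injective₁ P Q
  ... | refl with Pair₀-second P Q | Pair₀-second Q P
  ...   | inj₂ b≡d | _        = b≡d
  ...   | _        | inj₂ d≡b = sym d≡b
  ...   | inj₁ b≡a | inj₁ d≡a = trans b≡a (sym d≡a)

  Pair₀-carrier : ∀ {p a b} → Pair₀ p a b → Σ U λ u → u ∈ p × (a ∈ u × b ∈ u)
  Pair₀-carrier (_ , _ , s₂ , s₂∈p , _ , D₂ , _) = s₂ , s₂∈p , proj₂ D₂

  Pair₀-intro : ∀ {s₁ s₂ q a b} → Doubleton₀ s₁ a a → Doubleton₀ s₂ a b → Doubleton₀ q s₁ s₂ → Pair₀ q a b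
  Pair₀-intro D₁ D₂ Q = _ , proj₁ (proj₂ Q) , _ , proj₂ (proj₂ Q) , D₁ , D₂ , proj₁ Q

  Doubleton₀-⊆ : ∀ {s a b c} → Doubleton₀ s a b → a ∈ c → b ∈ c → _⊆_ S s c
  Doubleton₀-⊆ D a∈c b∈c w w∈s =
    [ (λ e → subst (_∈ _) (sym e) a∈c) , (λ e → subst (_∈ _) (sym e) b∈c) ]′ (proj₁ D w w∈s)

  Pair₀-members-⊆ : ∀ {p a b c} → Pair₀ p a b → a ∈ c → b ∈ c → (s : U) → s ∈ p → _⊆_ S s c
  Pair₀-members-⊆ (_ , _ , _ , _ , D₁ , D₂ , H) a∈c b∈c s s∈p =
    [ (λ e → subst (λ s → _⊆_ S s _) (sym e) (Doubleton₀-⊆ D₁ a∈c a∈c))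
    , (λ e → subst (λ s → _⊆_ S s _) (sym e) (Doubleton₀-⊆ D₂ a∈c b∈c)) ]′ (H s s∈p)

  Rel₀⇒InDom₀ : ∀ {g a y} → Rel₀ g a y → InDom₀ g a
  Rel₀⇒InDom₀ (p , p∈g , P) =
    let (u , u∈p , _ , y∈u) = Pair₀-carrier P in p , p∈g , u , u∈p , _ , y∈u , P

  InDom₀⇒Rel₀ : ∀ {g a} → InDom₀ g a → Σ U λ y → Rel₀ g a y
  InDom₀⇒Rel₀ (p , p∈g , _ , _ , y , _ , P) = y , p , p∈g , P

  Rel₀-mono : ∀ {g G} → _⊆_ S g G → ∀ {c z} → Rel₀ g c z → Rel₀ G c z
  Rel₀-mono g⊆G (p , p∈g , P) = p , g⊆G p p∈g , P

  InDom₀-mono : ∀ {g G} → _⊆_ S g G → ∀ {c} → InDom₀ g c → InDom₀ G c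
  InDom₀-mono g⊆G (p , p∈g , rest) = p , g⊆G p p∈g , rest

  PartialCollapse⇔Collapse : ∀ {E α g} → PartialCollapse E α g ⇔ Collapse E α g
  PartialCollapse⇔Collapse {E} {α} {g} = mk⇔ toView fromView
    where
    toView : PartialCollapse E α g → Collapse E α g
    toView (C₁ , C₃ , C₄) = record
      { graph    = λ p∈g → let (_ , _ , a , _ , _ , _ , y , _ , a∈α , P) = C₁ _ p∈g in a , y , a∈α , P
      ; downward = λ (p , p∈g , P) (r , r∈E , Q) →
          let (u , u∈p , b∈u , y∈u) = Pair₀-carrier P
              (w , w∈r , c∈w , _) = Pair₀-carrier Q
          in C₃ p p∈g u u∈p _ b∈u _ y∈u P r r∈E w w∈r _ c∈w Q
      ; values⊆  = λ (p , p∈g , P) z∈y →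
          let (u , u∈p , b∈u , y∈u) = Pair₀-carrier P
              (r , r∈E , _ , _ , c , _ , Q , R) = proj₁ (C₄ p p∈g u u∈p _ b∈u _ y∈u P) _ z∈y
          in c , (r , r∈E , Q) , R
      ; values⊇  = λ (p , p∈g , P) (r , r∈E , Q) (q , q∈g , P′) →
          let (u , u∈p , b∈u , y∈u) = Pair₀-carrier P
              (w , w∈r , c∈w , _) = Pair₀-carrier Q
              (v , v∈q , _ , z∈v) = Pair₀-carrier P′
          in proj₂ (C₄ p p∈g u u∈p _ b∈u _ y∈u P) r r∈E w w∈r _ c∈w q q∈g v v∈q _ z∈v Q P′
      }
    fromView : Collapse E α g → PartialCollapse E α g
    fromView C =
        (λ p p∈g → let (a , y , a∈α , P) = graph p∈g
                       (u , u∈p , a∈u , y∈u) = Pair₀-carrier P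
                   in u , u∈p , a , a∈u , u , u∈p , y , y∈u , a∈α , P)
      , (λ p p∈g _ _ _ _ _ _ P r r∈E _ _ _ _ Q → downward (p , p∈g , P) (r , r∈E , Q))
      , (λ p p∈g _ _ _ _ _ _ P →
            (λ z z∈y → let (c , (r , r∈E , Q) , R) = values⊆ (p , p∈g , P) z∈y
                           (w , w∈r , c∈w , _) = Pair₀-carrier Q
                       in r , r∈E , w , w∈r , c , c∈w , Q , R)
          , (λ r r∈E _ _ _ _ q q∈g _ _ _ _ Q P′ → values⊇ (p , p∈g , P) (r , r∈E , Q) (q , q∈g , P′)))
      where open Collapse C

  Collapse-dom⊆ : ∀ {E α g b y} → Collapse E α g → Rel₀ g b y → b ∈ α
  Collapse-dom⊆ C (p , p∈g , P) =
    let (a , _ , a∈α , Q) = Collapse.graph C p∈g in subst (_∈ _) (Pair₀-injective₁ Q P) a∈α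

module Pair₀-absolute (S : Structure)
    (extensionality : (x y : Structure.U S) →
       ((z : Structure.U S) → Structure._∈_ S z x ⇔ Structure._∈_ S z y) → x ≡ y)
    (pairing : (x y : Structure.U S) → Σ (Structure.U S) λ p → IsDoubleton S p x y) where
  open Structure S
  open BoundedNotions S

  Doubleton₀⇔IsDoubleton : ∀ {z a b} → Doubleton₀ z a b ⇔ IsDoubleton S z a b
  Doubleton₀⇔IsDoubleton = mk⇔
    (λ D w → mk⇔ (proj₁ D w) (λ { (inj₁ refl) → proj₁ (proj₂ D) ; (inj₂ refl) → proj₂ (proj₂ D) }))
    (λ D → (λ w w∈z → to (D w) w∈z) , from (D _) (inj₁ refl) , from (D _) (inj₂ refl))

  Doubleton₀-unique : ∀ {z z′ a b} → Doubleton₀ z a b → Doubleton₀ z′ a b → z ≡ z′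
  Doubleton₀-unique D D′ = extensionality _ _ λ w →
    mk⇔ (λ w∈z → from (to Doubleton₀⇔IsDoubleton D′ w) (proj₁ D w w∈z))
        (λ w∈z′ → from (to Doubleton₀⇔IsDoubleton D w) (proj₁ D′ w w∈z′))

  Pair₀⇔IsPair : ∀ {p a b} → Pair₀ p a b ⇔ IsPair S p a b
  Pair₀⇔IsPair {p} {a} {b} = mk⇔ toIsPair fromIsPair
    where
    toIsPair : Pair₀ p a b → IsPair S p a b
    toIsPair (_ , s₁∈p , _ , s₂∈p , D₁ , D₂ , H) z = mk⇔
      (λ z∈p → [ (λ { refl → inj₁ (to Doubleton₀⇔IsDoubleton D₁) })
               , (λ { refl → inj₂ (to Doubleton₀⇔IsDoubleton D₂) }) ]′ (H z z∈p))
      (λ { (inj₁ D) → subst (_∈ p) (Doubleton₀-unique D₁ (from Doubleton₀⇔IsDoubleton D)) s₁∈p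
         ; (inj₂ D) → subst (_∈ p) (Doubleton₀-unique D₂ (from Doubleton₀⇔IsDoubleton D)) s₂∈p })
    fromIsPair : IsPair S p a b → Pair₀ p a b
    fromIsPair P =
      let (s₁ , D₁) = pairing a a
          (s₂ , D₂) = pairing a b
      in s₁ , from (P s₁) (inj₁ D₁) , s₂ , from (P s₂) (inj₂ D₂)
         , from Doubleton₀⇔IsDoubleton D₁ , from Doubleton₀⇔IsDoubleton D₂
         , λ s s∈p → [ (λ D → inj₁ (same D D₁)) , (λ D → inj₂ (same D D₂)) ]′ (to (P s) s∈p)
      where
      same : ∀ {s t x y} → IsDoubleton S s x y → IsDoubleton S t x y → s ≡ t
      same D D′ = Doubleton₀-unique (from Doubleton₀⇔IsDoubleton D) (from Doubleton₀⇔IsDoubleton D′)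

  Rel₀⇔Rel : ∀ {g a b} → Rel₀ g a b ⇔ Rel S g a b
  Rel₀⇔Rel = mk⇔ (λ (p , p∈g , P) → p , p∈g , to Pair₀⇔IsPair P)
                 (λ (p , p∈g , P) → p , p∈g , from Pair₀⇔IsPair P)

module EndExtension-absoluteness (M : Structure) (I : Structure.U M → Bool)
    (∈-closed : EndExtension M I) where
  open Structure M

  N : Structure
  N = Sub M I

  In : U → Set
  In x = T (I x)

  member : ∀ {a} (b : Structure.U N) → a ∈ proj₁ b → Structure.U N
  member {a} b a∈b = a , ∈-closed (proj₁ b) a (proj₂ b) a∈b

  N-≡ : {a b : Structure.U N} → proj₁ a ≡ proj₁ b → a ≡ b
  N-≡ {x , p} {.x , q} refl = cong (x ,_) (T-irrelevant p q)

  Δ₀-absolute : ∀ {n} (φ : Formula n) → Δ₀ φ → (e : Vec (Structure.U N) n) →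
                Sat N e φ ⇔ Sat M (map proj₁ e) φ
  Δ₀-absolute (i ∈̇ j) (mem .i .j) e = mk⇔
    (subst₂ _∈_ (sym (lookup-map i proj₁ e)) (sym (lookup-map j proj₁ e)))
    (subst₂ _∈_ (lookup-map i proj₁ e) (lookup-map j proj₁ e))
  Δ₀-absolute (i ≐ j) (eq .i .j) e = mk⇔
    (λ q → trans (lookup-map i proj₁ e) (trans (cong proj₁ q) (sym (lookup-map j proj₁ e))))
    (λ q → N-≡ (trans (sym (lookup-map i proj₁ e)) (trans q (lookup-map j proj₁ e))))
  Δ₀-absolute ⊥̇ fls e = mk⇔ (λ x → x) (λ x → x)
  Δ₀-absolute (φ ⇒̇ ψ) (imp dφ dψ) e = mk⇔
    (λ h s → to (Δ₀-absolute ψ dψ e) (h (from (Δ₀-absolute φ dφ e) s)))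
    (λ h s → from (Δ₀-absolute ψ dψ e) (h (to (Δ₀-absolute φ dφ e) s)))
  Δ₀-absolute (φ ∧̇ ψ) (conj dφ dψ) e = mk⇔
    (λ (a , b) → to (Δ₀-absolute φ dφ e) a , to (Δ₀-absolute ψ dψ e) b)
    (λ (a , b) → from (Δ₀-absolute φ dφ e) a , from (Δ₀-absolute ψ dψ e) b)
  Δ₀-absolute (φ ∨̇ ψ) (disj dφ dψ) e = mk⇔
    [ (λ a → inj₁ (to (Δ₀-absolute φ dφ e) a)) , (λ b → inj₂ (to (Δ₀-absolute ψ dψ e) b)) ]′
    [ (λ a → inj₁ (from (Δ₀-absolute φ dφ e) a)) , (λ b → inj₂ (from (Δ₀-absolute ψ dψ e) b)) ]′
  Δ₀-absolute (∀∈̇ y φ) (ball .y dφ) e = mk⇔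
    (λ h a a∈y → let a∈y′ = subst (a ∈_) (lookup-map y proj₁ e) a∈y
                     a′ = member (lookup e y) a∈y′
                 in to (Δ₀-absolute φ dφ (a′ ∷ e)) (h a′ a∈y′))
    (λ h a a∈y → from (Δ₀-absolute φ dφ (a ∷ e))
                   (h (proj₁ a) (subst (proj₁ a ∈_) (sym (lookup-map y proj₁ e)) a∈y)))
  Δ₀-absolute (∃∈̇ y φ) (bex .y dφ) e = mk⇔
    (λ (a , a∈y , s) → proj₁ a , subst (proj₁ a ∈_) (sym (lookup-map y proj₁ e)) a∈y
                       , to (Δ₀-absolute φ dφ (a ∷ e)) s)
    (λ (a , a∈y , s) → let a∈y′ = subst (a ∈_) (lookup-map y proj₁ e) a∈y
                           a′ = member (lookup e y) a∈y′
                       in a′ , a∈y′ , from (Δ₀-absolute φ dφ (a′ ∷ e)) s)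

  Ordinal-absolute : ∀ {k} → Ordinal N k ⇔ Ordinal M (proj₁ k)
  Ordinal-absolute {k} = mk⇔
    (λ (tr , trans∈ , tri) →
        (λ y y∈k z z∈y → let y′ = member k y∈k in tr y′ y∈k (member y′ z∈y) z∈y)
      , (λ x y z x∈k y∈k z∈k → trans∈ (member k x∈k) (member k y∈k) (member k z∈k) x∈k y∈k z∈k)
      , (λ x y x∈k y∈k → [ inj₁ , [ (λ e → inj₂ (inj₁ (cong proj₁ e))) , (λ m → inj₂ (inj₂ m)) ]′ ]′
                            (tri (member k x∈k) (member k y∈k) x∈k y∈k)))
    (λ (tr , trans∈ , tri) →
        (λ y y∈k z z∈y → tr (proj₁ y) y∈k (proj₁ z) z∈y)
      , (λ x y z x∈k y∈k z∈k → trans∈ _ _ _ x∈k y∈k z∈k)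
      , (λ x y x∈k y∈k → [ inj₁ , [ (λ e → inj₂ (inj₁ (N-≡ e))) , (λ m → inj₂ (inj₂ m)) ]′ ]′
                            (tri _ _ x∈k y∈k)))

module Collapses (S : Structure) (lem : ExcludedMiddle 0ℓ) (MS : MOST S) where
  open Structure S
  open MOST MS
  open BoundedNotions S
  open BoundedNotions-properties S
  open Collapse

  classical : {P : Set} → ¬ ¬ P → P
  classical = decidable-stable lem

  ⊆-antisym : ∀ {x y} → _⊆_ S x y → _⊆_ S y x → x ≡ y
  ⊆-antisym x⊆y y⊆x = extensionality _ _ λ z → mk⇔ (x⊆y z) (y⊆x z)

  module _ {E α : U} (pred∈α : ∀ {c b} → Rel₀ E c b → c ∈ α) (wf : WellFoundedOn E α) where

    values-⊆ : ∀ {g₁ g₂ m y₁ y₂} → Collapse E α g₁ → Collapse E α g₂ →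
      (∀ {c z₁ z₂} → Rel₀ E c m → Rel₀ g₁ c z₁ → Rel₀ g₂ c z₂ → z₁ ≡ z₂) →
      Rel₀ g₁ m y₁ → Rel₀ g₂ m y₂ → _⊆_ S y₁ y₂
    values-⊆ C₁ C₂ agree R₁ R₂ z z∈y₁ =
      let (c , Ec , R₁c) = values⊆ C₁ R₁ z∈y₁
          (_ , R₂c) = InDom₀⇒Rel₀ (downward C₂ R₂ Ec)
      in subst (_∈ _) (sym (agree Ec R₁c R₂c)) (values⊇ C₂ R₂ Ec R₂c)

    -- An E-minimal point where two collapses disagree has, by extensionality, equal values.
    Collapse-unique : ∀ {g₁ g₂ b y₁ y₂} → Collapse E α g₁ → Collapse E α g₂ →
                      Rel₀ g₁ b y₁ → Rel₀ g₂ b y₂ → y₁ ≡ y₂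
    Collapse-unique {g₁} {g₂} C₁ C₂ R₁ R₂ = classical λ y₁≢y₂ →
      let (m , m∈D , minimal) = wf D D⊆α (_ , D-intro (Collapse-dom⊆ C₁ R₁) R₁ R₂ y₁≢y₂)
          (_ , _ , R₁m , R₂m , m-disagrees) = D-elim m∈D
          agree : ∀ {c z₁ z₂} → Rel₀ E c m → Rel₀ g₁ c z₁ → Rel₀ g₂ c z₂ → z₁ ≡ z₂
          agree Ec R₁c R₂c = classical λ z₁≢z₂ → minimal _ (D-intro (pred∈α Ec) R₁c R₂c z₁≢z₂) Ec
      in m-disagrees (⊆-antisym (values-⊆ C₁ C₂ agree R₁m R₂m)
                                (values-⊆ C₂ C₁ (λ Ec R₂c R₁c → sym (agree Ec R₁c R₂c)) R₂m R₁m))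
      where
      disagreeᶠ : Formula 3
      disagreeᶠ = ∃∈̇ (# 1) (∃∈̇ (# 0) (∃∈̇ (# 0) (∃∈̇ (# 5) (∃∈̇ (# 0) (∃∈̇ (# 0)
        (pairᶠ (# 5) (# 6) (# 3) ∧̇ (pairᶠ (# 2) (# 6) (# 0) ∧̇ (((# 3) ≐ (# 0)) ⇒̇ ⊥̇))))))))
      D-sep : Σ U λ D → (c : U) → c ∈ D ⇔ (c ∈ α × Sat S (c ∷ g₁ ∷ g₂ ∷ []) disagreeᶠ)
      D-sep = Δ₀-separation disagreeᶠ bounded-Δ₀ (g₁ ∷ g₂ ∷ []) α
      D : U
      D = proj₁ D-sep
      D⊆α : _⊆_ S D α
      D⊆α c c∈D = proj₁ (to (proj₂ D-sep c) c∈D)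
      D-intro : ∀ {c z₁ z₂} → c ∈ α → Rel₀ g₁ c z₁ → Rel₀ g₂ c z₂ → ¬ z₁ ≡ z₂ → c ∈ D
      D-intro c∈α (p , p∈g₁ , P) (q , q∈g₂ , Q) z₁≢z₂ =
        let (u , u∈p , _ , z₁∈u) = Pair₀-carrier P
            (v , v∈q , _ , z₂∈v) = Pair₀-carrier Q
        in from (proj₂ D-sep _) (c∈α , p , p∈g₁ , u , u∈p , _ , z₁∈u , q , q∈g₂ , v , v∈q , _ , z₂∈v , P , Q , z₁≢z₂)
      D-elim : ∀ {c} → c ∈ D → Σ U λ z₁ → Σ U λ z₂ → Rel₀ g₁ c z₁ × Rel₀ g₂ c z₂ × ¬ z₁ ≡ z₂
      D-elim c∈D with to (proj₂ D-sep _) c∈D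
      ... | _ , p , p∈g₁ , _ , _ , z₁ , _ , q , q∈g₂ , _ , _ , z₂ , _ , P , Q , z₁≢z₂ =
        z₁ , z₂ , (p , p∈g₁ , P) , (q , q∈g₂ , Q) , z₁≢z₂

    Collapse-⋃ : ∀ {B G} → ((g : U) → g ∈ B → Collapse E α g) →
                 ((p : U) → p ∈ G ⇔ (Σ U λ g → g ∈ B × p ∈ g)) → Collapse E α G
    Collapse-⋃ {B} {G} all-collapses G≡⋃B = record
      { graph    = λ p∈G → let (g , g∈B , p∈g) = to (G≡⋃B _) p∈G in graph (all-collapses g g∈B) p∈g
      ; downward = λ (p , p∈G , P) Ec → let (g , g∈B , p∈g) = to (G≡⋃B _) p∈G in
          InDom₀-mono (⊆G g∈B) (downward (all-collapses g g∈B) (p , p∈g , P) Ec)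
      ; values⊆  = λ (p , p∈G , P) z∈y →
          let (g , g∈B , p∈g) = to (G≡⋃B _) p∈G
              (c , Ec , R) = values⊆ (all-collapses g g∈B) (p , p∈g , P) z∈y
          in c , Ec , Rel₀-mono (⊆G g∈B) R
      ; values⊇  = λ (p , p∈G , P) Ec (q , q∈G , Q) →
          let (g , g∈B , p∈g) = to (G≡⋃B _) p∈G
              (g′ , g′∈B , q∈g′) = to (G≡⋃B _) q∈G
              (_ , R) = InDom₀⇒Rel₀ (downward (all-collapses g g∈B) (p , p∈g , P) Ec)
          in subst (_∈ _) (Collapse-unique (all-collapses g g∈B) (all-collapses g′ g′∈B) R (q , q∈g′ , Q))
                   (values⊇ (all-collapses g g∈B) (p , p∈g , P) Ec R)
      }
      where
      ⊆G : ∀ {g} → g ∈ B → _⊆_ S g G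
      ⊆G g∈B p p∈g = from (G≡⋃B p) (_ , g∈B , p∈g)

    Collapse-insert : ∀ {G m Y q g′} → Collapse E α G → m ∈ α → ¬ InDom₀ G m →
      (∀ {c} → Rel₀ E c m → InDom₀ G c) →
      ((z : U) → z ∈ Y ⇔ (Σ U λ c → Rel₀ E c m × Rel₀ G c z)) → Pair₀ q m Y →
      ((p : U) → p ∈ g′ ⇔ (p ∈ G ⊎ p ≡ q)) → Collapse E α g′
    Collapse-insert {G} {m} {Y} {q} {g′} C m∈α m∉G preds∈G Y≡values Q g′≡G+q = record
      { graph    = λ {p} p∈g′ → [ graph C , (λ { refl → m , Y , m∈α , Q }) ]′ (to (g′≡G+q p) p∈g′)
      ; downward = λ (p , p∈g′ , P) Ec → [ (λ p∈G → InDom₀-mono G⊆g′ (downward C (p , p∈G , P) Ec))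
                                         , (λ { refl → InDom₀-mono G⊆g′ (preds∈G (at-m P Ec)) }) ]′
                                         (to (g′≡G+q _) p∈g′)
      ; values⊆  = λ (p , p∈g′ , P) z∈y → [ (λ p∈G → shift (values⊆ C (p , p∈G , P) z∈y))
                                          , (λ { refl → shift (at-q P z∈y) }) ]′
                                          (to (g′≡G+q _) p∈g′)
      ; values⊇  = λ (p , p∈g′ , P) Ec (q′ , q′∈g′ , P′) →
          values⊇-cases P Ec P′ (to (g′≡G+q _) p∈g′) (to (g′≡G+q _) q′∈g′)
      }
      where
      G⊆g′ : _⊆_ S G g′
      G⊆g′ p p∈G = from (g′≡G+q p) (inj₁ p∈G)
      at-m : ∀ {b y c} → Pair₀ q b y → Rel₀ E c b → Rel₀ E c m
      at-m P Ec = subst (Rel₀ E _) (sym (Pair₀-injective₁ Q P)) Ec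
      at-q : ∀ {b y z} → Pair₀ q b y → z ∈ y → Σ U λ c → Rel₀ E c b × Rel₀ G c z
      at-q P z∈y with Pair₀-injective₁ Q P | Pair₀-injective₂ Q P
      ... | refl | refl = to (Y≡values _) z∈y
      shift : ∀ {b z} → Σ U (λ c → Rel₀ E c b × Rel₀ G c z) → Σ U λ c → Rel₀ E c b × Rel₀ g′ c z
      shift (c , Ec , R) = c , Ec , Rel₀-mono G⊆g′ R
      q∉G : ∀ {p b y c z} → p ∈ G → Pair₀ p b y → Rel₀ E c b → Pair₀ q c z → ⊥
      q∉G p∈G P Ec P′ =
        m∉G (subst (InDom₀ G) (sym (Pair₀-injective₁ Q P′)) (downward C (_ , p∈G , P) Ec))
      values⊇-cases : ∀ {p b y c q′ z} → Pair₀ p b y → Rel₀ E c b → Pair₀ q′ c z →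
                      p ∈ G ⊎ p ≡ q → q′ ∈ G ⊎ q′ ≡ q → z ∈ y
      values⊇-cases P Ec P′ (inj₁ p∈G) (inj₁ q′∈G) = values⊇ C (_ , p∈G , P) Ec (_ , q′∈G , P′)
      values⊇-cases P Ec P′ (inj₁ p∈G) (inj₂ refl) = ⊥-elim (q∉G p∈G P Ec P′)
      values⊇-cases P Ec P′ (inj₂ refl) (inj₁ q′∈G) =
        subst (_ ∈_) (Pair₀-injective₂ Q P) (from (Y≡values _) (_ , at-m P Ec , (_ , q′∈G , P′)))
      values⊇-cases P Ec P′ (inj₂ refl) (inj₂ refl) = ⊥-elim (
        m∉G (preds∈G (subst (λ c → Rel₀ E c m) (sym (Pair₀-injective₁ Q P′)) (at-m P Ec))))

module HCutConstructions (M : Structure) (MM : MOST M) (I : Structure.U M → Bool)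
    (pp : PowersetPreserving M I) (MN : MOST (Sub M I)) where
  open Structure M
  open MOST MM
  open BoundedNotions M
  open BoundedNotions-properties M
  open EndExtension-absoluteness M I (proj₁ pp) public
  private module N = MOST MN

  ∈-closed : EndExtension M I
  ∈-closed = proj₁ pp

  ⊆-closed : (x y : U) → In y → _⊆_ M x y → In x
  ⊆-closed = proj₂ pp

  record SetIn (P : U → Set) : Set where
    constructor setIn
    field
      set     : U
      set∈I   : In set
      members : (z : U) → z ∈ set ⇔ P z

  open SetIn public

  opaque
    doubleton-I : ∀ {a b} → In a → In b → Σ U λ p → In p × Doubleton₀ p a b
    doubleton-I {a} {b} a∈I b∈I with N.pairing (a , a∈I) (b , b∈I)
    ... | (p , p∈I) , D =
      p , p∈I , (λ w w∈p → [ (λ e → inj₁ (cong proj₁ e)) , (λ e → inj₂ (cong proj₁ e)) ]′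
                              (to (D (member (p , p∈I) w∈p)) w∈p))
            , from (D (a , a∈I)) (inj₁ refl) , from (D (b , b∈I)) (inj₂ refl)

    pair-I : ∀ {a b} → In a → In b → Σ U λ q → In q × Pair₀ q a b
    pair-I a∈I b∈I =
      let (s₁ , s₁∈I , D₁) = doubleton-I a∈I a∈I
          (s₂ , s₂∈I , D₂) = doubleton-I a∈I b∈I
          (q , q∈I , D) = doubleton-I s₁∈I s₂∈I
      in q , q∈I , Pair₀-intro D₁ D₂ D

    ⋃-I : ∀ {x} → In x → SetIn λ z → Σ U λ y → y ∈ x × z ∈ y
    ⋃-I {x} x∈I with N.union (x , x∈I)
    ... | (u , u∈I) , D =
      setIn u u∈I λ z → mk⇔
        (λ z∈u → let (y , y∈x , z∈y) = to (D (member (u , u∈I) z∈u)) z∈u in proj₁ y , y∈x , z∈y)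
        (λ (y , y∈x , z∈y) → let y′ = member (x , x∈I) y∈x in
                             from (D (member y′ z∈y)) (y′ , y∈x , z∈y))

    𝒫-I : ∀ {x} → In x → SetIn λ z → _⊆_ M z x
    𝒫-I {x} x∈I with N.powerset (x , x∈I)
    ... | (P , P∈I) , D =
      setIn P P∈I λ z → mk⇔
        (λ z∈P w w∈z → let z′ = member (P , P∈I) z∈P in to (D z′) z∈P (member z′ w∈z) w∈z)
        (λ z⊆x → from (D (z , ⊆-closed z x x∈I z⊆x)) (λ w w∈z → z⊆x (proj₁ w) w∈z))

    ∪-I : ∀ {a b} → In a → In b → SetIn λ z → z ∈ a ⊎ z ∈ b
    ∪-I a∈I b∈I =
      let (d , d∈I , D) = doubleton-I a∈I b∈I
          (setIn u u∈I ⋃d) = ⋃-I d∈I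
      in setIn u u∈I λ z → mk⇔
        (λ z∈u → let (y , y∈d , z∈y) = to (⋃d z) z∈u in
                 [ (λ e → inj₁ (subst (z ∈_) e z∈y)) , (λ e → inj₂ (subst (z ∈_) e z∈y)) ]′ (proj₁ D y y∈d))
        [ (λ z∈a → from (⋃d z) (_ , proj₁ (proj₂ D) , z∈a)) , (λ z∈b → from (⋃d z) (_ , proj₂ (proj₂ D) , z∈b)) ]′

    insert-I : ∀ {G q} → In G → In q → SetIn λ p → p ∈ G ⊎ p ≡ q
    insert-I G∈I q∈I =
      let (s , s∈I , D) = doubleton-I q∈I q∈I
          (setIn g g∈I G∪s) = ∪-I G∈I s∈I
      in setIn g g∈I λ p → mk⇔
        (λ p∈g → [ inj₁ , (λ p∈s → inj₂ (Doubleton₀-singleton D p∈s)) ]′ (to (G∪s p) p∈g))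
        [ (λ p∈G → from (G∪s p) (inj₁ p∈G)) , (λ { refl → from (G∪s p) (inj₂ (proj₁ (proj₂ D))) }) ]′

    separation-I : ∀ {n} (φ : Formula (suc n)) → Δ₀ φ → (ps : Vec U n) → ∀ {x} → In x →
      SetIn λ z → z ∈ x × Sat M (z ∷ ps) φ
    separation-I φ dφ ps {x} x∈I =
      let (y , D) = Δ₀-separation φ dφ ps x
      in setIn y (⊆-closed y x x∈I (λ z z∈y → proj₁ (to (D z) z∈y))) D

    ∃-separation-I : ∀ {n} (ψ : Formula (suc (suc n))) → Δ₀ ψ → (ps : Vec (Structure.U N) n) → ∀ {x} → In x →
      SetIn λ z → z ∈ x × Σ U λ g → In g × Sat M (g ∷ z ∷ map proj₁ ps) ψ
    ∃-separation-I ψ dψ ps {x} x∈I with N.Σ₁-separation (∃̇ ψ) (ex (base dψ)) ps (x , x∈I)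
    ... | (y , y∈I) , D =
      setIn y y∈I λ z → mk⇔
        (λ z∈y → let z′ = member (y , y∈I) z∈y
                     (z∈x , g , s) = to (D z′) z∈y
                 in z∈x , proj₁ g , proj₂ g , to (Δ₀-absolute ψ dψ (g ∷ z′ ∷ ps)) s)
        (λ (z∈x , g , g∈I , s) → let z′ = member (x , x∈I) z∈x in
          from (D z′) (z∈x , (g , g∈I) , from (Δ₀-absolute ψ dψ ((g , g∈I) ∷ z′ ∷ ps)) s))

    collection-I : ∀ {n} (φ : Formula (suc (suc n))) → Δ₀ φ → (ps : Vec (Structure.U N) n) → ∀ {a} → In a →
      ((x : U) → x ∈ a → Σ U λ y → In y × Sat M (y ∷ x ∷ map proj₁ ps) φ) →
      Σ U λ b → In b × ((x : U) → x ∈ a → Σ U λ y → y ∈ b × Sat M (y ∷ x ∷ map proj₁ ps) φ)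
    collection-I φ dφ ps {a} a∈I H
      with N.Δ₀-collection φ dφ ps (a , a∈I)
             (λ x x∈a → let (y , y∈I , s) = H (proj₁ x) x∈a in (y , y∈I) , from (Δ₀-absolute φ dφ ((y , y∈I) ∷ x ∷ ps)) s)
    ... | (b , b∈I) , D =
      b , b∈I , λ x x∈a → let x′ = member (a , a∈I) x∈a
                              ((y , y∈I) , y∈b , s) = D x′ x∈a
                          in y , y∈b , to (Δ₀-absolute φ dφ ((y , y∈I) ∷ x′ ∷ ps)) s

  private
    module PairM = Pair₀-absolute M extensionality pairing
    module PairN = Pair₀-absolute N N.extensionality N.pairing

  IsPair-absolute : ∀ p a b → IsPair N p a b ⇔ IsPair M (proj₁ p) (proj₁ a) (proj₁ b)
  IsPair-absolute p a b =
    PairM.Pair₀⇔IsPair {proj₁ p} {proj₁ a} {proj₁ b}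
      ⇔-∘ (Δ₀-absolute (pairᶠ (# 0) (# 1) (# 2)) bounded-Δ₀ (p ∷ a ∷ b ∷ [])
      ⇔-∘ ⇔-sym (PairN.Pair₀⇔IsPair {p} {a} {b}))

  Rel-absolute : ∀ f a b → Rel N f a b ⇔ Rel M (proj₁ f) (proj₁ a) (proj₁ b)
  Rel-absolute f a b = mk⇔
    (λ (p , p∈f , P) → proj₁ p , p∈f , to (IsPair-absolute p a b) P)
    (λ (p , p∈f , P) → let p′ = member f p∈f in p′ , p∈f , from (IsPair-absolute p′ a b) P)

  Rel-components-I : ∀ {f x y} → In f → Rel M f x y → In x × In y
  Rel-components-I f∈I (p , p∈f , P) =
    let p∈I = ∈-closed _ p f∈I p∈f
        (u , u∈p , x∈u , y∈u) = Pair₀-carrier (from PairM.Pair₀⇔IsPair P)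
        u∈I = ∈-closed p u p∈I u∈p
    in ∈-closed u _ u∈I x∈u , ∈-closed u _ u∈I y∈u

  Bijection-I : ∀ {f a b} → In a → In b → Bijection M f a b → In f
  Bijection-I {f} a∈I b∈I (graph , _) =
    let (setIn u u∈I a∪b) = ∪-I a∈I b∈I
        (setIn P P∈I 𝒫u) = 𝒫-I u∈I
        (setIn PP PP∈I 𝒫P) = 𝒫-I P∈I
    in ⊆-closed f PP PP∈I λ p p∈f →
         let (x , x∈a , y , y∈b , Pxy) = graph p p∈f in
         from (𝒫P p) λ s s∈p → from (𝒫u s)
           (Pair₀-members-⊆ (from PairM.Pair₀⇔IsPair Pxy) (from (a∪b x) (inj₁ x∈a)) (from (a∪b y) (inj₂ y∈b)) s s∈p)

  Bijection-absolute : ∀ {f a b} → Bijection N f a b ⇔ Bijection M (proj₁ f) (proj₁ a) (proj₁ b)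
  Bijection-absolute {f} {a} {b} = mk⇔ down up
    where
    down : Bijection N f a b → Bijection M (proj₁ f) (proj₁ a) (proj₁ b)
    down (graph , total , functional , injective , onto) =
        (λ p p∈f → let (x , x∈a , y , y∈b , P) = graph (member f p∈f) p∈f
                   in proj₁ x , x∈a , proj₁ y , y∈b , to (IsPair-absolute (member f p∈f) x y) P)
      , (λ x x∈a → let (y , y∈b , R) = total (member a x∈a) x∈a in proj₁ y , y∈b , to (Rel-absolute f (member a x∈a) y) R)
      , (λ x y y′ R R′ → let (x∈I , y∈I) = Rel-components-I (proj₂ f) R
                             (_ , y′∈I) = Rel-components-I (proj₂ f) R′
                         in cong proj₁ (functional (x , x∈I) (y , y∈I) (y′ , y′∈I)
                              (from (Rel-absolute f _ _) R) (from (Rel-absolute f _ _) R′)))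
      , (λ x x′ y R R′ → let (x∈I , y∈I) = Rel-components-I (proj₂ f) R
                             (x′∈I , _) = Rel-components-I (proj₂ f) R′
                         in cong proj₁ (injective (x , x∈I) (x′ , x′∈I) (y , y∈I)
                              (from (Rel-absolute f _ _) R) (from (Rel-absolute f _ _) R′)))
      , (λ y y∈b → let (x , x∈a , R) = onto (member b y∈b) y∈b in proj₁ x , x∈a , to (Rel-absolute f x (member b y∈b)) R)
    up : Bijection M (proj₁ f) (proj₁ a) (proj₁ b) → Bijection N f a b
    up (graph , total , functional , injective , onto) =
        (λ p p∈f → let (x , x∈a , y , y∈b , P) = graph (proj₁ p) p∈f
                   in member a x∈a , x∈a , member b y∈b , y∈b , from (IsPair-absolute p (member a x∈a) (member b y∈b)) P)
      , (λ x x∈a → let (y , y∈b , R) = total (proj₁ x) x∈a in member b y∈b , y∈b , from (Rel-absolute f x (member b y∈b)) R)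
      , (λ x y y′ R R′ → N-≡ (functional _ _ _ (to (Rel-absolute f x y) R) (to (Rel-absolute f x y′) R′)))
      , (λ x x′ y R R′ → N-≡ (injective _ _ _ (to (Rel-absolute f x y) R) (to (Rel-absolute f x′ y) R′)))
      , (λ y y∈b → let (x , x∈a , R) = onto (proj₁ y) y∈b in member a x∈a , x∈a , from (Rel-absolute f (member a x∈a) y) R)

  IsTC-absolute : ∀ {t x} → IsTC N t x ⇔ IsTC M (proj₁ t) (proj₁ x)
  IsTC-absolute {t} {x} = mk⇔
    (λ (x⊆t , t-transitive , t-least) →
        (λ z z∈x → x⊆t (member x z∈x) z∈x)
      , (λ y y∈t z z∈y → t-transitive (member t y∈t) y∈t (member (member t y∈t) z∈y) z∈y)
      , λ s x⊆s s-transitive →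
          let (setIn s∩t s∩t∈I D) = separation-I ((# 0) ∈̇ (# 1)) bounded-Δ₀ (s ∷ []) (proj₂ t)
              t⊆s∩t = t-least (s∩t , s∩t∈I) (λ z z∈x → from (D (proj₁ z)) (x⊆t z z∈x , x⊆s (proj₁ z) z∈x))
                        (λ y y∈s∩t z z∈y → let (y∈t , y∈s) = to (D (proj₁ y)) y∈s∩t in
                          from (D (proj₁ z)) (t-transitive y y∈t z z∈y , s-transitive _ y∈s _ z∈y))
          in λ z z∈t → proj₂ (to (D z) (t⊆s∩t (member t z∈t) z∈t)))
    (λ (x⊆t , t-transitive , t-least) →
        (λ z z∈x → x⊆t (proj₁ z) z∈x)
      , (λ y y∈t z z∈y → t-transitive _ y∈t _ z∈y)
      , λ s x⊆s s-transitive z z∈t →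
          t-least (proj₁ s) (λ w w∈x → x⊆s (member x w∈x) w∈x)
            (λ y y∈s w w∈y → s-transitive (member s y∈s) y∈s (member (member s y∈s) w∈y) w∈y) (proj₁ z) z∈t)

  SmallTC-down : ∀ {k x} → SmallTC N k x → SmallTC M (proj₁ k) (proj₁ x)
  SmallTC-down {x = x} (t , TC , α , α∈k , f , bij) =
    proj₁ t , to (IsTC-absolute {t} {x}) TC , proj₁ α , α∈k , proj₁ f , to (Bijection-absolute {f} {α} {t}) bij

  module CollapseExistence (lem : ExcludedMiddle 0ℓ) {E κ : U} (E∈I : In E) (κ∈I : In κ)
      (pred∈κ : ∀ {c b} → Rel₀ E c b → c ∈ κ) (wf : WellFoundedOn E κ) where
    open Collapses M lem MM

    Collapsible : U → Set
    Collapsible a = Σ U λ g → In g × Collapse E κ g × InDom₀ g a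

    private
      collapsibleᶠ : Formula 4
      collapsibleᶠ = partialCollapseᶠ (# 2) (# 3) (# 0) ∧̇ inDomᶠ (# 0) (# 1)

      parameters : Vec (Structure.U N) 2
      parameters = (E , E∈I) ∷ (κ , κ∈I) ∷ []

    collapse-covering : ∀ {P} → In P → ((a : U) → a ∈ P → Collapsible a) →
                        Σ U λ G → In G × Collapse E κ G × ((a : U) → a ∈ P → InDom₀ G a)
    collapse-covering {P} P∈I covered =
      set G , set∈I G , Collapse-⋃ pred∈κ wf (λ g g∈B′ → to PartialCollapse⇔Collapse (proj₂ (to (members B′ g) g∈B′)))
                                     (members G)
      , G-covers
      where
      witnesses : Σ U λ B → In B × ((a : U) → a ∈ P → Σ U λ g → g ∈ B × (PartialCollapse E κ g × InDom₀ g a))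
      witnesses = collection-I collapsibleᶠ bounded-Δ₀ parameters P∈I
        (λ a a∈P → let (g , g∈I , C , a∈g) = covered a a∈P in g , g∈I , from PartialCollapse⇔Collapse C , a∈g)
      B′ : SetIn λ g → g ∈ proj₁ witnesses × PartialCollapse E κ g
      B′ = separation-I (partialCollapseᶠ (# 1) (# 2) (# 0)) bounded-Δ₀
                        (E ∷ κ ∷ []) (proj₁ (proj₂ witnesses))
      G : SetIn λ p → Σ U λ g → g ∈ set B′ × p ∈ g
      G = ⋃-I (set∈I B′)
      G-covers : (a : U) → a ∈ P → InDom₀ (set G) a
      G-covers a a∈P =
        let (g , g∈B , C , (p , p∈g , rest)) = proj₂ (proj₂ witnesses) a a∈P
        in p , from (members G p) (g , from (members B′ g) (g∈B , C) , p∈g) , rest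

    collapse-predecessors : ∀ {m} → m ∈ κ → (∀ {c} → Rel₀ E c m → Collapsible c) →
      Σ U λ G → In G × Collapse E κ G × (∀ {c} → Rel₀ E c m → InDom₀ G c)
    collapse-predecessors {m} m∈κ preds-collapsible =
      let (G , G∈I , C , covers) = collapse-covering (set∈I preds)
            (λ c c∈preds → preds-collapsible (proj₂ (to (members preds c) c∈preds)))
      in G , G∈I , C , λ Ec → covers _ (from (members preds _) (pred∈κ Ec , Ec))
      where
      preds : SetIn λ c → c ∈ κ × Rel₀ E c m
      preds = separation-I (relᶠ (# 1) (# 0) (# 2)) bounded-Δ₀ (E ∷ m ∷ []) κ∈I

    collapse-extend : ∀ {G m} → In G → Collapse E κ G → m ∈ κ → ¬ InDom₀ G m →
                      (∀ {c} → Rel₀ E c m → InDom₀ G c) → Collapsible m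
    collapse-extend {G} {m} G∈I C m∈κ m∉G pred∈G =
      set g′ , set∈I g′ , Collapse-insert pred∈κ wf C m∈κ m∉G pred∈G Y≡values Q (members g′)
      , Rel₀⇒InDom₀ (q , from (members g′ q) (inj₂ refl) , Q)
      where
      valuesᶠ : Formula 4
      valuesᶠ = ∃∈̇ (# 1) (∃∈̇ (# 0) (∃∈̇ (# 0) (pairᶠ (# 2) (# 0) (# 5) ∧̇ relᶠ (# 6) (# 0) (# 3))))
      ⋃G : SetIn λ u → Σ U λ p → p ∈ G × u ∈ p
      ⋃G = ⋃-I G∈I
      ⋃⋃G : SetIn λ z → Σ U λ u → u ∈ set ⋃G × z ∈ u
      ⋃⋃G = ⋃-I (set∈I ⋃G)
      Y : SetIn λ z → z ∈ set ⋃⋃G × Sat M (z ∷ E ∷ m ∷ G ∷ []) valuesᶠ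
      Y = separation-I valuesᶠ bounded-Δ₀ (E ∷ m ∷ G ∷ []) (set∈I ⋃⋃G)
      Y≡values : (z : U) → z ∈ set Y ⇔ (Σ U λ c → Rel₀ E c m × Rel₀ G c z)
      Y≡values z = mk⇔
        (λ z∈Y → let (_ , r , r∈E , _ , _ , c , _ , P , R) = to (members Y z) z∈Y in c , (r , r∈E , P) , R)
        (λ (c , (r , r∈E , P) , (p , p∈G , P′)) →
          let (u , u∈p , _ , z∈u) = Pair₀-carrier P′
              (w , w∈r , c∈w , _) = Pair₀-carrier P
              u∈⋃G = from (members ⋃G u) (p , p∈G , u∈p)
          in from (members Y z) (from (members ⋃⋃G z) (u , u∈⋃G , z∈u) , r , r∈E , w , w∈r , c , c∈w , P , (p , p∈G , P′)))
      q-pair : Σ U λ q → In q × Pair₀ q m (set Y)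
      q-pair = pair-I (∈-closed κ m κ∈I m∈κ) (set∈I Y)
      q : U
      q = proj₁ q-pair
      Q : Pair₀ q m (set Y)
      Q = proj₂ (proj₂ q-pair)
      g′ : SetIn λ p → p ∈ G ⊎ p ≡ q
      g′ = insert-I G∈I (proj₁ (proj₂ q-pair))

    collapsible-step : ∀ {m} → m ∈ κ → (∀ {c} → Rel₀ E c m → Collapsible c) → Collapsible m
    collapsible-step {m} m∈κ preds-collapsible =
      let (G , G∈I , C , pred∈G) = collapse-predecessors m∈κ preds-collapsible
      in case lem {InDom₀ G m} of λ where
           (yes m∈G) → G , G∈I , C , m∈G
           (no m∉G)  → collapse-extend G∈I C m∈κ m∉G pred∈G

    collapsible : ∀ {a} → a ∈ κ → Collapsible a
    collapsible {a} a∈κ = classical λ a-not-collapsible →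
      let (m , m∈S , minimal) = wf S S⊆κ (a , S-intro a∈κ a-not-collapsible)
          (m∈κ , m∉D) = to (S≡ m) m∈S
      in m∉D (D-intro m∈κ (collapsible-step m∈κ λ Ec →
                classical λ c-not-collapsible → minimal _ (S-intro (pred∈κ Ec) c-not-collapsible) Ec))
      where
      D : SetIn λ c → c ∈ κ × Σ U λ g → In g × (PartialCollapse E κ g × InDom₀ g c)
      D = ∃-separation-I collapsibleᶠ bounded-Δ₀ parameters κ∈I
      D-intro : ∀ {c} → c ∈ κ → Collapsible c → c ∈ set D
      D-intro c∈κ (g , g∈I , C , c∈g) = from (members D _) (c∈κ , g , g∈I , from PartialCollapse⇔Collapse C , c∈g)
      D-elim : ∀ {c} → c ∈ set D → Collapsible c
      D-elim c∈D = let (_ , g , g∈I , C , c∈g) = to (members D _) c∈D in g , g∈I , to PartialCollapse⇔Collapse C , c∈g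
      S-sep : Σ U λ S → (c : U) → c ∈ S ⇔ (c ∈ κ × ¬ c ∈ set D)
      S-sep = Δ₀-separation (((# 0) ∈̇ (# 1)) ⇒̇ ⊥̇) bounded-Δ₀ (set D ∷ []) κ
      S : U
      S = proj₁ S-sep
      S≡ : (c : U) → c ∈ S ⇔ (c ∈ κ × ¬ c ∈ set D)
      S≡ = proj₂ S-sep
      S⊆κ : _⊆_ M S κ
      S⊆κ c c∈S = proj₁ (to (S≡ c) c∈S)
      S-intro : ∀ {c} → c ∈ κ → ¬ Collapsible c → c ∈ S
      S-intro c∈κ c-not-collapsible = from (S≡ _) (c∈κ , λ c∈D → c-not-collapsible (D-elim c∈D))

  module SmallSets (lem : ExcludedMiddle 0ℓ) {κ : U} (κ∈I : In κ) (κ-transitive : Transitive M κ) where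
    open Collapses M lem MM using (Collapse-unique)

    𝒫κ : SetIn λ z → _⊆_ M z κ
    𝒫κ = 𝒫-I κ∈I

    𝒫𝒫κ : SetIn λ z → _⊆_ M z (set 𝒫κ)
    𝒫𝒫κ = 𝒫-I (set∈I 𝒫κ)

    -- The ∈-relation of t pulled back along f to α, as a set of pairs.
    module Code {α t f : U} (α∈κ : α ∈ κ) (t-transitive : Transitive M t) (bij : Bijection M f α t) where
      α⊆κ : _⊆_ M α κ
      α⊆κ = κ-transitive α α∈κ

      α∈I : In α
      α∈I = ∈-closed κ α κ∈I α∈κ

      f-total : ∀ {a} → a ∈ α → Σ U λ y → y ∈ t × Rel₀ f a y
      f-total a∈α = let (y , y∈t , R) = proj₁ (proj₂ bij) _ a∈α in y , y∈t , from PairM.Rel₀⇔Rel R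

      f-functional : ∀ {a y y′} → Rel₀ f a y → Rel₀ f a y′ → y ≡ y′
      f-functional R R′ = proj₁ (proj₂ (proj₂ bij)) _ _ _ (to PairM.Rel₀⇔Rel R) (to PairM.Rel₀⇔Rel R′)

      f-onto : ∀ {y} → y ∈ t → Σ U λ a → a ∈ α × Rel₀ f a y
      f-onto y∈t = let (a , a∈α , R) = proj₂ (proj₂ (proj₂ (proj₂ bij))) _ y∈t in a , a∈α , from PairM.Rel₀⇔Rel R

      f-graph : ∀ {a y} → Rel₀ f a y → a ∈ α × y ∈ t
      f-graph (p , p∈f , P) =
        let (a , a∈α , y , y∈t , P′) = proj₁ bij p p∈f
            P₀ = from PairM.Pair₀⇔IsPair P′
        in subst (_∈ α) (Pair₀-injective₁ P₀ P) a∈α , subst (_∈ t) (Pair₀-injective₂ P₀ P) y∈t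

      private
        codeᶠ : Formula 3
        codeᶠ = ∃∈̇ (# 1) (∃∈̇ (# 2) (∃∈̇ (# 4) (∃∈̇ (# 0) (∃∈̇ (# 0) (∃∈̇ (# 7) (∃∈̇ (# 0) (∃∈̇ (# 0)
          (pairᶠ (# 5) (# 7) (# 3) ∧̇ (pairᶠ (# 2) (# 6) (# 0) ∧̇ (((# 3) ∈̇ (# 0)) ∧̇ pairᶠ (# 8) (# 7) (# 6)))))))))))
        E-set : SetIn λ r → r ∈ set 𝒫𝒫κ × Sat M (r ∷ α ∷ f ∷ []) codeᶠ
        E-set = separation-I codeᶠ bounded-Δ₀ (α ∷ f ∷ []) (set∈I 𝒫𝒫κ)

      E : U
      E = set E-set

      E∈I : In E
      E∈I = set∈I E-set

      E⊆𝒫𝒫κ : _⊆_ M E (set 𝒫𝒫κ)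
      E⊆𝒫𝒫κ r r∈E = proj₁ (to (members E-set r) r∈E)

      record Related (c b : U) : Set where
        field
          {y₁ y₂} : U
          c∈α     : c ∈ α
          b∈α     : b ∈ α
          fc≡y₁   : Rel₀ f c y₁
          fb≡y₂   : Rel₀ f b y₂
          y₁∈y₂   : y₁ ∈ y₂

      E-intro : ∀ {c b y₁ y₂} → c ∈ α → b ∈ α → Rel₀ f c y₁ → Rel₀ f b y₂ → y₁ ∈ y₂ → Rel₀ E c b
      E-intro {c} {b} {y₁} {y₂} c∈α b∈α (p , p∈f , P) (q , q∈f , Q) y₁∈y₂ =
        let (r , _ , R) = pair-I (∈-closed α c α∈I c∈α) (∈-closed α b α∈I b∈α)
            (u , u∈p , _ , y₁∈u) = Pair₀-carrier P
            (v , v∈q , _ , y₂∈v) = Pair₀-carrier Q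
            r∈𝒫𝒫κ = from (members 𝒫𝒫κ r) λ s s∈r →
                      from (members 𝒫κ s) (Pair₀-members-⊆ R (α⊆κ c c∈α) (α⊆κ b b∈α) s s∈r)
        in r , from (members E-set r) (r∈𝒫𝒫κ , c , c∈α , b , b∈α , p , p∈f , u , u∈p , y₁ , y₁∈u
                                       , q , q∈f , v , v∈q , y₂ , y₂∈v , P , Q , y₁∈y₂ , R) , R

      opaque
        E-elim : ∀ {c b} → Rel₀ E c b → Related c b
        E-elim (r , r∈E , R) with to (members E-set r) r∈E
        ... | _ , _ , c∈α , _ , b∈α , p , p∈f , _ , _ , _ , _ , q , q∈f , _ , _ , _ , _ , P , Q , y₁∈y₂ , R′
          with Pair₀-injective₁ R′ R | Pair₀-injective₂ R′ R
        ... | refl | refl = record { c∈α = c∈α ; b∈α = b∈α ; fc≡y₁ = p , p∈f , P ; fb≡y₂ = q , q∈f , Q ; y₁∈y₂ = y₁∈y₂ }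

      E-pred∈κ : ∀ {c b} → Rel₀ E c b → c ∈ κ
      E-pred∈κ Ec = α⊆κ _ (Related.c∈α (E-elim Ec))

      E-field⊆α : ∀ {r u a} → r ∈ E → u ∈ r → a ∈ u → a ∈ α
      E-field⊆α {r} r∈E u∈r a∈u with to (members E-set r) r∈E
      ... | _ , _ , c∈α , _ , b∈α , _ , _ , _ , _ , _ , _ , _ , _ , _ , _ , _ , _ , _ , _ , _ , R =
        Pair₀-members-⊆ R c∈α b∈α _ u∈r _ a∈u

      -- A minimal element of s is found via foundation applied to the image f[s ∩ α].
      E-wellFounded : WellFoundedOn E κ
      E-wellFounded s _ (z , z∈s) = case lem {Σ U λ a → a ∈ s × a ∈ α} of λ where
          (no s∩α≡∅) → z , z∈s , λ c _ Ec → s∩α≡∅ (z , z∈s , Related.b∈α (E-elim Ec))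
          (yes (a , a∈s , a∈α)) →
            let (y , y∈t , p , p∈f , P) = f-total a∈α
                (y₀ , y₀∈image , y₀-minimal) = setFoundation image (y , from (image≡ y) (y∈t , a , a∈s , p , p∈f , P))
                (_ , m , m∈s , p₀ , p₀∈f , P₀) = to (image≡ y₀) y₀∈image
            in m , m∈s , λ c c∈s Ec →
              let related = E-elim Ec
                  (q , q∈f , Q) = Related.fc≡y₁ related
                  fm≡y₀ = f-functional (Related.fb≡y₂ related) (p₀ , p₀∈f , P₀)
              in y₀-minimal (Related.y₁ related) (subst (Related.y₁ related ∈_) fm≡y₀ (Related.y₁∈y₂ related))
                   (from (image≡ (Related.y₁ related)) (proj₂ (f-graph (q , q∈f , Q)) , c , c∈s , q , q∈f , Q))
        where
        imageᶠ : Formula 3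
        imageᶠ = ∃∈̇ (# 1) (∃∈̇ (# 3) (pairᶠ (# 0) (# 1) (# 2)))
        image-sep : Σ U λ image → (y : U) → y ∈ image ⇔ (y ∈ t × Σ U λ a → a ∈ s × Rel₀ f a y)
        image-sep = Δ₀-separation imageᶠ bounded-Δ₀ (s ∷ f ∷ []) t
        image : U
        image = proj₁ image-sep
        image≡ : (y : U) → y ∈ image ⇔ (y ∈ t × Σ U λ a → a ∈ s × Rel₀ f a y)
        image≡ = proj₂ image-sep

      f-collapse : Collapse E κ f
      f-collapse = record
        { graph    = λ p∈f → let (a , a∈α , y , _ , P) = proj₁ bij _ p∈f in a , y , α⊆κ a a∈α , from PairM.Pair₀⇔IsPair P
        ; downward = λ _ Ec → let (_ , _ , R) = f-total (Related.c∈α (E-elim Ec)) in Rel₀⇒InDom₀ R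
        ; values⊆  = λ R z∈y → let (b∈α , y∈t) = f-graph R
                                   (c , c∈α , R′) = f-onto (t-transitive _ y∈t _ z∈y)
                               in c , E-intro c∈α b∈α R′ R z∈y , R′
        ; values⊇  = λ R Ec R′ → let related = E-elim Ec in
            subst₂ _∈_ (f-functional (Related.fc≡y₁ related) R′) (f-functional (Related.fb≡y₂ related) R)
                       (Related.y₁∈y₂ related)
        }

    private
      codesᶠ : Formula 3
      codesᶠ = partialCollapseᶠ (# 1) (# 2) (# 0) ∧̇ fieldInDomᶠ (# 1) (# 0)

      𝒫𝒫𝒫κ : SetIn λ E → _⊆_ M E (set 𝒫𝒫κ)
      𝒫𝒫𝒫κ = 𝒫-I (set∈I 𝒫𝒫κ)

      codes : SetIn λ E → E ∈ set 𝒫𝒫𝒫κ × Σ U λ g → In g × (PartialCollapse E κ g × FieldInDom E g)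
      codes = ∃-separation-I codesᶠ bounded-Δ₀ ((κ , κ∈I) ∷ []) (set∈I 𝒫𝒫𝒫κ)

      collapses : Σ U λ B → In B ×
        ((E : U) → E ∈ set codes → Σ U λ g → g ∈ B × (PartialCollapse E κ g × FieldInDom E g))
      collapses = collection-I codesᶠ bounded-Δ₀ ((κ , κ∈I) ∷ []) (set∈I codes)
                    (λ E E∈codes → proj₂ (to (members codes E) E∈codes))

      ⋃B : SetIn λ p → Σ U λ g → g ∈ proj₁ collapses × p ∈ g
      ⋃B = ⋃-I (proj₁ (proj₂ collapses))

      ⋃⋃B : SetIn λ u → Σ U λ p → p ∈ set ⋃B × u ∈ p
      ⋃⋃B = ⋃-I (set∈I ⋃B)

      values : SetIn λ z → Σ U λ u → u ∈ set ⋃⋃B × z ∈ u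
      values = ⋃-I (set∈I ⋃⋃B)

      bound : SetIn λ y → _⊆_ M y (set values)
      bound = 𝒫-I (set∈I values)

    Bound : U
    Bound = set bound

    Bound∈I : In Bound
    Bound∈I = set∈I bound

    -- z ∈ y ∈ t is f(c) with c E f⁻¹(y); so c lies in the field of E, hence in the domain of
    -- one of the collected collapses g, and g(c) = f(c) because collapses are unique.
    transitive-small-⊆-Bound : ∀ {α t f} → α ∈ κ → Transitive M t → Bijection M f α t → _⊆_ M t Bound
    transitive-small-⊆-Bound {α} {t} {f} α∈κ t-transitive bij y y∈t =
      from (members bound y) λ z z∈y →
        let (a , a∈α , Ray) = f-onto y∈t
            (c , c∈α , Rcz) = f-onto (t-transitive y y∈t z z∈y)
            (r , r∈E , Rca) = E-intro c∈α a∈α Rcz Ray z∈y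
            (u , u∈r , c∈u , _) = Pair₀-carrier Rca
            (z′ , p , p∈g , P) = InDom₀⇒Rel₀ (g-field r r∈E u u∈r c c∈u)
            (v , v∈p , _ , z′∈v) = Pair₀-carrier P
            p∈⋃B = from (members ⋃B p) (g , g∈B , p∈g)
            v∈⋃⋃B = from (members ⋃⋃B v) (p , p∈⋃B , v∈p)
        in subst (_∈ _) (Collapse-unique E-pred∈κ E-wellFounded g-collapse f-collapse (p , p∈g , P) Rcz)
                 (from (members values z′) (v , v∈⋃⋃B , z′∈v))
      where
      open Code α∈κ t-transitive bij
      open CollapseExistence lem E∈I κ∈I E-pred∈κ E-wellFounded
      E∈codes : E ∈ set codes
      E∈codes =
        let (G , G∈I , C , covers) = collapse-covering α∈I (λ a a∈α → collapsible (α⊆κ a a∈α)) in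
        from (members codes E)
          (from (members 𝒫𝒫𝒫κ E) E⊆𝒫𝒫κ , G , G∈I , from PartialCollapse⇔Collapse C
          , λ r r∈E u u∈r a a∈u → covers a (E-field⊆α r∈E u∈r a∈u))
      g : U
      g = proj₁ (proj₂ (proj₂ collapses) E E∈codes)
      g∈B : g ∈ proj₁ collapses
      g∈B = proj₁ (proj₂ (proj₂ (proj₂ collapses) E E∈codes))
      g-collapse : Collapse E κ g
      g-collapse = to PartialCollapse⇔Collapse (proj₁ (proj₂ (proj₂ (proj₂ (proj₂ collapses) E E∈codes))))
      g-field : FieldInDom E g
      g-field = proj₂ (proj₂ (proj₂ (proj₂ (proj₂ collapses) E E∈codes)))

    SmallTC-up : ∀ {x} → SmallTC M κ x → Σ (In x) λ x∈I → SmallTC N (κ , κ∈I) (x , x∈I)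
    SmallTC-up {x} (t , TC , α , α∈κ , f , bij) =
      x∈I , (t , t∈I) , from (IsTC-absolute {t , t∈I} {x , x∈I}) TC , (α , α∈I) , α∈κ
          , (f , f∈I) , from (Bijection-absolute {f , f∈I} {α , α∈I} {t , t∈I}) bij
      where
      t∈I : In t
      t∈I = ⊆-closed t Bound Bound∈I (transitive-small-⊆-Bound α∈κ (proj₁ (proj₂ TC)) bij)
      x∈I : In x
      x∈I = ⊆-closed x t t∈I (proj₁ TC)
      α∈I : In α
      α∈I = ∈-closed κ α κ∈I α∈κ
      f∈I : In f
      f∈I = Bijection-I α∈I t∈I bij

    small⊆Bound : ∀ {x} → SmallTC M κ x → _⊆_ M x Bound
    small⊆Bound (t , TC , _ , α∈κ , _ , bij) z z∈x =
      transitive-small-⊆-Bound α∈κ (proj₁ (proj₂ TC)) bij z (proj₁ TC z z∈x)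

    IsH-absolute : (h : U) → IsH M κ h ⇔ (Σ (In h) λ h∈I → IsH N (κ , κ∈I) (h , h∈I))
    IsH-absolute h = mk⇔
      (λ H → h∈I H , λ x → mk⇔
        (λ x∈h → let (x∈I , small) = SmallTC-up (to (H (proj₁ x)) x∈h) in
                 subst (SmallTC N (κ , κ∈I)) (N-≡ {_ , x∈I} {x} refl) small)
        (λ small → from (H (proj₁ x)) (SmallTC-down {κ , κ∈I} {x} small)))
      (λ (h∈I , H) x → mk⇔
        (λ x∈h → SmallTC-down {κ , κ∈I} {member (h , h∈I) x∈h} (to (H (member (h , h∈I) x∈h)) x∈h))
        (λ small → let (x∈I , small′) = SmallTC-up small in from (H (x , x∈I)) small′))
      where
      h∈I : IsH M κ h → In h
      h∈I H = let (setIn 𝒫B 𝒫B∈I 𝒫B≡) = 𝒫-I Bound∈I in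
        ⊆-closed h 𝒫B 𝒫B∈I λ x x∈h → from (𝒫B≡ x) (small⊆Bound (to (H x) x∈h))

  Cardinal-absolute : ∀ {κ} (κ∈I : In κ) → Cardinal N (κ , κ∈I) ⇔ Cardinal M κ
  Cardinal-absolute {κ} κ∈I = mk⇔
    (λ (ordinal , no-bijection) → to (Ordinal-absolute {κ , κ∈I}) ordinal , λ α α∈κ (f , bij) →
      let α′ = member (κ , κ∈I) α∈κ
          f′ = (f , Bijection-I (proj₂ α′) κ∈I bij)
      in no-bijection α′ α∈κ (f′ , from (Bijection-absolute {f′} {α′} {κ , κ∈I}) bij))
    (λ (ordinal , no-bijection) → from (Ordinal-absolute {κ , κ∈I}) ordinal , λ α α∈κ (f , bij) →
      no-bijection (proj₁ α) α∈κ (proj₁ f , to (Bijection-absolute {f} {α} {κ , κ∈I}) bij))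

lemma3p1 : ExcludedMiddle 0ℓ →
    (M : Structure) → MOST M →
    (I : Structure.U M → Bool) → HCut M I →
    (κ : Structure.U M) (iκ : T (I κ)) →
    (Cardinal (Sub M I) (κ , iκ) ⇔ Cardinal M κ)
    × (Cardinal M κ →
        (h : Structure.U M) →
          IsH M κ h ⇔ (Σ (T (I h)) λ ih → IsH (Sub M I) (κ , iκ) (h , ih)))
lemma3p1 lem M MM I (_ , pp , MN) κ κ∈I =
  Cardinal-absolute κ∈I , λ κ-cardinal → SmallSets.IsH-absolute lem κ∈I (proj₁ (proj₁ κ-cardinal))
  where open HCutConstructions M MM I pp MN
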